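{- Let $(A,\leq)$ be a finite partially ordered set and $R\subseteq A\times A$ be convex with respect to $\leq$. Then $t(R)=t_r(t_\ell(R))$. In particular, if $G=(V,E)$ is a finite directed graph with vertex weights $w:V\to\mathbb{R}^+$ such that $w(u)<w(v)$ for all $(u,v)\in E$, edge costs $d((u,v))=w(v)-w(u)$, and $\gamma\geq 0$, then, with respect to the partial order $\leq_E$ given by the reflexive and transitive closure of $E$, $t_r(t_\ell(R_{G,\gamma}))$ is the set of tight pairs of $G$ at threshold $\gamma$.
   Context: $R\subseteq A\times A$ is convex with respect to $\leq$ if $(a,b)\in R$ implies $a\leq b$, and whenever $a\leq b\leq c$ and $(a,c)\in R$, then $(a,b)\in R$ and $(b,c)\in R$. Using $\leq$ on both factors: $t(R)=\{(a,b)\in R\mid \forall a',b'\in A\,((a'\leq a\wedge b\leq b'\wedge (a',b')\in R)\Rightarrow(a'=a\wedge b'=b))\}$; $t_r(R)=\{(a,b)\in R\mid \forall b'\in A\,((b\leq b'\wedge (a,b')\in R)\Rightarrow b'=b)\}$; $t_\ell(R)=\{(a,b)\in R\mid \forall a'\in A\,((a'\leq a\wedge (a',b)\in R)\Rightarrow a'=a)\}$. For the graph: a path is a sequence $(u_1,\ldots,u_k)$, $k\geq1$, with $(u_i,u_{i+1})\in E$, of cost equal to the sum of its edge costs. A path $p=(u_1,\ldots,u_k)$ is tight if its cost is $\leq\gamma$ and every path obtained by adding one new edge $(u_0,u_1)\in E$ at the start or $(u_k,u_{k+1})\in E$ at the end has cost $>\gamma$. A tight pair is a pair $(u,v)$ such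 that some tight path starts at $u$ and ends at $v$. $R_{G,\gamma}$ is the set of pairs $(u,v)\in V\times V$ such that there is a path from $u$ to $v$ in $G$ and $w(v)-w(u)\leq\gamma$. -}

module Defs where

open import Level using (0ℓ)
open import Data.Nat using (ℕ)
open import Data.Fin using (Fin)
open import Data.Product using (Σ; _×_; _,_)
open import Relation.Binary.PropositionalEquality using (_≡_; _≢_)
open import Relation.Binary.Structures using (IsPartialOrder; IsTotalOrder)
open import Algebra.Structures using (IsAbelianGroup)
open import Function.Bundles using (_↔_)

Finite : Set → Set
Finite A = Σ ℕ (λ n → A ↔ Fin n)

module _ {A : Set} (_≤_ : A → A → Set) where

  Convex : (A → A → Set) → Set
  Convex R =
    (∀ {a b} → R a b → a ≤ b) ×
    (∀ {a b c} → a ≤ b → b ≤ c → R a c → R a b × R b c)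

  t : (A → A → Set) → A → A → Set
  t R a b = R a b ×
    (∀ a' b' → a' ≤ a → b ≤ b' → R a' b' → (a' ≡ a) × (b' ≡ b))

  tr : (A → A → Set) → A → A → Set
  tr R a b = R a b × (∀ b' → b ≤ b' → R a b' → b' ≡ b)

  tℓ : (A → A → Set) → A → A → Set
  tℓ R a b = R a b × (∀ a' → a' ≤ a → R a' b → a' ≡ a)

-- Abstract stand-in for the real numbers: a totally ordered abelian
-- group (ℝ with + and ≤ is an instance).  Only +, -, ≤, < are used.

record OrderedAbelianGroup : Set₁ where
  infixl 6 _+_ _-_
  infix 4 _≤_ _<_
  field
    Carrier : Set
    _+_     : Carrier → Carrier → Carrier
    0#      : Carrier
    -_      : Carrier → Carrier
    _≤_     : Carrier → Carrier → Set
    isAbelianGroup : IsAbelianGroup _≡_ _+_ 0# -_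
    isTotalOrder   : IsTotalOrder _≡_ _≤_
    +-mono-≤ : ∀ {x y} z → x ≤ y → (x + z) ≤ (y + z)

  _-_ : Carrier → Carrier → Carrier
  x - y = x + (- y)

  _<_ : Carrier → Carrier → Set
  x < y = (x ≤ y) × (x ≢ y)

module Graph (𝕂 : OrderedAbelianGroup) {V : Set}
             (E : V → V → Set) (w : V → OrderedAbelianGroup.Carrier 𝕂) where
  open OrderedAbelianGroup 𝕂

  d : ∀ {u v} → E u v → Carrier
  d {u} {v} _ = w v - w u

  data Path : V → V → Set where
    [_] : (u : V) → Path u u
    _∷_ : ∀ {u₀ u v} → E u₀ u → Path u v → Path u₀ v

  cost : ∀ {u v} → Path u v → Carrier
  cost [ u ]    = 0#
  cost (e ∷ p) = d e + cost p

  _∷ʳ_ : ∀ {u v v'} → Path u v → E v v' → Path u v'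
  [ u ]   ∷ʳ e = e ∷ [ _ ]
  (e' ∷ p) ∷ʳ e = e' ∷ (p ∷ʳ e)

  Tight : (γ : Carrier) → ∀ {u v} → Path u v → Set
  Tight γ {u} {v} p =
    (cost p ≤ γ) ×
    (∀ u₀ (e : E u₀ u) → γ < cost (e ∷ p)) ×
    (∀ v' (e : E v v') → γ < cost (p ∷ʳ e))

  TightPair : (γ : Carrier) → V → V → Set
  TightPair γ u v = Σ (Path u v) (Tight γ)

  RG : (γ : Carrier) → V → V → Set
  RG γ u v = Σ (Path u v) (λ _ → (w v - w u) ≤ γ)

{-# OPTIONS --safe #-}
module Submission where

-- In a convex relation, if a is left-minimal for b then it stays left-minimal for every b' ≥ b;
-- hence a pair that is right-maximal among the left-minimal pairs is extremal in both
-- coordinates, which is t(R) = t_r(t_ℓ(R)).  In the graph, path costs telescope to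
-- w(v) - w(u) and weights increase along paths, so R_{G,γ} is convex for the reachability
-- order.  Its extremal pairs are the tight pairs: a one-edge extension of a path within
-- budget would be a strictly larger pair of R_{G,γ}; conversely, for a strictly larger pair
-- (u', v'), the last edge of u' →* u (or the first edge of v →* v') extends the path within
-- budget.

open import Defs
open import Level using (0ℓ)
open import Data.Empty using (⊥-elim)
open import Data.Product using (_×_; _,_; proj₁; proj₂; ∃-syntax)
open import Data.Sum using (_⊎_; inj₁; inj₂)
open import Relation.Nullary using (¬_)
open import Relation.Binary.Core using (Rel)
open import Relation.Binary.Definitions using (Reflexive; Transitive)
open import Relation.Binary.PropositionalEquality using (_≡_; refl; sym; cong; subst)
open import Relation.Binary.Structures using (IsPreorder; IsPartialOrder)
open import Relation.Binary.Bundles using (TotalOrder)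
open import Relation.Binary.Construct.Closure.ReflexiveTransitive using (Star; ε; _◅_)
import Relation.Binary.Construct.Closure.ReflexiveTransitive.Properties as Star
open import Algebra.Bundles using (AbelianGroup)
open import Function.Bundles using (_⇔_; mk⇔)
open import Function.Construct.Composition using (_⇔-∘_)
open import Function.Construct.Symmetry using (⇔-sym)

module _ {A : Set} {_≤_ : A → A → Set} {R : A → A → Set} where

  t⇒tr∘tℓ : Reflexive _≤_ → ∀ {a b} → t _≤_ R a b → tr _≤_ (tℓ _≤_ R) a b
  t⇒tr∘tℓ ≤-refl (Rab , extremal) =
    (Rab , λ a' a'≤a Ra'b → proj₁ (extremal a' _ a'≤a ≤-refl Ra'b)) ,
    λ b' b≤b' (Rab' , _) → proj₂ (extremal _ b' ≤-refl b≤b' Rab')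

  -- Convexity moves R a' b' down to R a' b, where the minimality of a applies.
  tℓ-leftmost-upward : Transitive _≤_ → Convex _≤_ R →
    ∀ {a b b'} → tℓ _≤_ R a b → b ≤ b' → ∀ a' → a' ≤ a → R a' b' → a' ≡ a
  tℓ-leftmost-upward ≤-trans (R⇒≤ , R-split) (Rab , leftmost) b≤b' a' a'≤a Ra'b' =
    leftmost a' a'≤a (proj₁ (R-split (≤-trans a'≤a (R⇒≤ Rab)) b≤b' Ra'b'))

  tr∘tℓ⇒t : Transitive _≤_ → Convex _≤_ R → ∀ {a b} → tr _≤_ (tℓ _≤_ R) a b → t _≤_ R a b
  tr∘tℓ⇒t ≤-trans convex {a} {b} (tℓab , rightmost) = proj₁ tℓab , extremal
    where
    extremal : ∀ a' b' → a' ≤ a → b ≤ b' → R a' b' → a' ≡ a × b' ≡ b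
    extremal a' b' a'≤a b≤b' Ra'b' = a'≡a , rightmost b' b≤b' (Rab' , leftmost')
      where
      leftmost' : ∀ a'' → a'' ≤ a → R a'' b' → a'' ≡ a
      leftmost' = tℓ-leftmost-upward ≤-trans convex tℓab b≤b'
      a'≡a : a' ≡ a
      a'≡a = leftmost' a' a'≤a Ra'b'
      Rab' : R a b'
      Rab' = subst (λ x → R x b') a'≡a Ra'b'

  t⇔tr∘tℓ : IsPreorder _≡_ _≤_ → Convex _≤_ R → ∀ a b → t _≤_ R a b ⇔ tr _≤_ (tℓ _≤_ R) a b
  t⇔tr∘tℓ preorder convex a b =
    mk⇔ (t⇒tr∘tℓ (IsPreorder.refl preorder)) (tr∘tℓ⇒t (IsPreorder.trans preorder) convex)

unsnoc : ∀ {I : Set} {T : Rel I 0ℓ} {i j} → Star T i j → i ≡ j ⊎ ∃[ k ] (Star T i k × T k j)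
unsnoc ε = inj₁ refl
unsnoc (x ◅ xs) with unsnoc xs
... | inj₁ refl = inj₂ (_ , ε , x)
... | inj₂ (k , xs' , x') = inj₂ (k , x ◅ xs' , x')

module OrderedAbelianGroupProperties (𝕂 : OrderedAbelianGroup) where
  open OrderedAbelianGroup 𝕂

  abelianGroup : AbelianGroup 0ℓ 0ℓ
  abelianGroup = record
    { Carrier = Carrier ; _≈_ = _≡_ ; _∙_ = _+_ ; ε = 0# ; _⁻¹ = -_
    ; isAbelianGroup = isAbelianGroup }

  totalOrder : TotalOrder 0ℓ 0ℓ 0ℓ
  totalOrder = record { Carrier = Carrier ; _≈_ = _≡_ ; _≤_ = _≤_ ; isTotalOrder = isTotalOrder }

  open AbelianGroup abelianGroup public using (comm; assoc; inverseʳ)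
  open import Algebra.Properties.AbelianGroup abelianGroup using (\\-leftDividesˡ; //-rightDividesˡ)
  open TotalOrder totalOrder public using () renaming (refl to ≤-refl; trans to ≤-trans)
  open import Relation.Binary.Properties.TotalOrder totalOrder public using (≰⇒>; <⇒≱)

  -‿telescope : ∀ x y z → (y - x) + (z - y) ≡ z - x
  -‿telescope x y z = begin
    (y - x) + (z - y)  ≡⟨ comm (y - x) (z - y) ⟩
    (z - y) + (y - x)  ≡⟨ assoc (z - y) y (- x) ⟨
    ((z - y) + y) - x  ≡⟨ cong (_- x) (//-rightDividesˡ y z) ⟩
    z - x              ∎
    where open Relation.Binary.PropositionalEquality.≡-Reasoning

  neg-antimono-≤ : ∀ {x y} → x ≤ y → - y ≤ - x
  neg-antimono-≤ {x} {y} x≤y = begin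
    - y                ≡⟨ \\-leftDividesˡ x (- y) ⟨
    x + (- x + - y)    ≤⟨ +-mono-≤ (- x + - y) x≤y ⟩
    y + (- x + - y)    ≡⟨ cong (y +_) (comm (- x) (- y)) ⟩
    y + (- y + - x)    ≡⟨ \\-leftDividesˡ y (- x) ⟩
    - x                ∎
    where open import Relation.Binary.Reasoning.PartialOrder (TotalOrder.poset totalOrder)

  -‿mono-≤ : ∀ {x x' y y'} → y ≤ y' → x' ≤ x → y - x ≤ y' - x'
  -‿mono-≤ {x} {x'} {y} {y'} y≤y' x'≤x = begin
    y - x     ≤⟨ +-mono-≤ (- x) y≤y' ⟩
    y' - x    ≡⟨ comm y' (- x) ⟩
    - x + y'  ≤⟨ +-mono-≤ y' (neg-antimono-≤ x'≤x) ⟩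
    - x' + y' ≡⟨ comm (- x') y' ⟩
    y' - x'   ∎
    where open import Relation.Binary.Reasoning.PartialOrder (TotalOrder.poset totalOrder)

module GraphProperties (𝕂 : OrderedAbelianGroup) {V : Set} (E : V → V → Set)
  (w : V → OrderedAbelianGroup.Carrier 𝕂)
  (w-increasing : ∀ u v → E u v → OrderedAbelianGroup._<_ 𝕂 (w u) (w v)) where
  open OrderedAbelianGroup 𝕂
  open OrderedAbelianGroupProperties 𝕂
  open Graph 𝕂 E w

  cost-telescopes : ∀ {u v} (p : Path u v) → cost p ≡ w v - w u
  cost-telescopes [ u ] = sym (inverseʳ (w u))
  cost-telescopes {u₀} (_∷_ {u = u} {v = v} e p) = begin
    (w u - w u₀) + cost p       ≡⟨ cong ((w u - w u₀) +_) (cost-telescopes p) ⟩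
    (w u - w u₀) + (w v - w u)  ≡⟨ -‿telescope (w u₀) (w u) (w v) ⟩
    w v - w u₀                  ∎
    where open Relation.Binary.PropositionalEquality.≡-Reasoning

  Path⇒Star : ∀ {u v} → Path u v → Star E u v
  Path⇒Star [ u ] = ε
  Path⇒Star (e ∷ p) = e ◅ Path⇒Star p

  Star⇒Path : ∀ {u v} → Star E u v → Path u v
  Star⇒Path ε = [ _ ]
  Star⇒Path (e ◅ s) = e ∷ Star⇒Path s

  E-irreflexive : ∀ {u} → ¬ E u u
  E-irreflexive e = proj₂ (w-increasing _ _ e) refl

  w-mono-Star : ∀ {u v} → Star E u v → w u ≤ w v
  w-mono-Star ε = ≤-refl
  w-mono-Star (e ◅ s) = ≤-trans (proj₁ (w-increasing _ _ e)) (w-mono-Star s)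

  gap-mono-Star : ∀ {u u' v v'} → Star E u' u → Star E v v' → w v - w u ≤ w v' - w u'
  gap-mono-Star u'≤u v≤v' = -‿mono-≤ (w-mono-Star v≤v') (w-mono-Star u'≤u)

  module _ (γ : Carrier) where

    RG-intro : ∀ {u v} (p : Path u v) → cost p ≤ γ → RG γ u v
    RG-intro p cost≤γ = p , subst (_≤ γ) (cost-telescopes p) cost≤γ

    RG-convex : Convex (Star E) (RG γ)
    RG-convex = (λ (p , _) → Path⇒Star p) , split
      where
      split : ∀ {a b c} → Star E a b → Star E b c → RG γ a c → RG γ a b × RG γ b c
      split a≤b b≤c (_ , gap≤γ) =
        (Star⇒Path a≤b , ≤-trans (gap-mono-Star ε b≤c) gap≤γ) ,
        (Star⇒Path b≤c , ≤-trans (gap-mono-Star a≤b ε) gap≤γ)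

    t⇒TightPair : ∀ {u v} → t (Star E) (RG γ) u v → TightPair γ u v
    t⇒TightPair {u} {v} ((p , gap≤γ) , extremal) =
      p , subst (_≤ γ) (sym (cost-telescopes p)) gap≤γ , start-blocked , end-blocked
      where
      start-blocked : ∀ u₀ (e : E u₀ u) → γ < cost (e ∷ p)
      start-blocked u₀ e = ≰⇒> λ cost≤γ →
        let u₀≡u = proj₁ (extremal u₀ v (e ◅ ε) ε (RG-intro (e ∷ p) cost≤γ))
        in E-irreflexive (subst (λ x → E x u) u₀≡u e)
      end-blocked : ∀ v' (e : E v v') → γ < cost (p ∷ʳ e)
      end-blocked v' e = ≰⇒> λ cost≤γ →
        let v'≡v = proj₂ (extremal u v' ε (e ◅ ε) (RG-intro (p ∷ʳ e) cost≤γ))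
        in E-irreflexive (subst (E v) v'≡v e)

    TightPair⇒t : ∀ {u v} → TightPair γ u v → t (Star E) (RG γ) u v
    TightPair⇒t {u} {v} (p , cost≤γ , start-blocked , end-blocked) = RG-intro p cost≤γ , extremal
      where
      extremal : ∀ u' v' → Star E u' u → Star E v v' → RG γ u' v' → u' ≡ u × v' ≡ v
      extremal u' v' u'≤u v≤v' (_ , gap≤γ) = no-earlier-start (unsnoc u'≤u) , no-later-end v≤v'
        where
        inside : ∀ {x y} → Star E u' x → Star E y v' → w y - w x ≤ γ
        inside u'≤x y≤v' = ≤-trans (gap-mono-Star u'≤x y≤v') gap≤γ

        no-earlier-start : u' ≡ u ⊎ ∃[ u₀ ] (Star E u' u₀ × E u₀ u) → u' ≡ u
        no-earlier-start (inj₁ u'≡u) = u'≡u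
        no-earlier-start (inj₂ (u₀ , u'≤u₀ , e)) = ⊥-elim (<⇒≱ (start-blocked u₀ e)
          (subst (_≤ γ) (sym (cost-telescopes (e ∷ p))) (inside u'≤u₀ v≤v')))

        no-later-end : Star E v v' → v' ≡ v
        no-later-end ε = refl
        no-later-end (e ◅ v₁≤v') = ⊥-elim (<⇒≱ (end-blocked _ e)
          (subst (_≤ γ) (sym (cost-telescopes (p ∷ʳ e))) (inside u'≤u v₁≤v')))

    t⇔TightPair : ∀ u v → t (Star E) (RG γ) u v ⇔ TightPair γ u v
    t⇔TightPair u v = mk⇔ t⇒TightPair TightPair⇒t

theorem2 :
    ((A : Set) → Finite A → (_≤_ : A → A → Set) → IsPartialOrder _≡_ _≤_ →
      (R : A → A → Set) → Convex _≤_ R →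
      ∀ a b → t _≤_ R a b ⇔ tr _≤_ (tℓ _≤_ R) a b)
    ×
    ((𝕂 : OrderedAbelianGroup) → (V : Set) → Finite V → (E : V → V → Set) →
      (w : V → OrderedAbelianGroup.Carrier 𝕂) →
      (∀ v → OrderedAbelianGroup._<_ 𝕂 (OrderedAbelianGroup.0# 𝕂) (w v)) →
      (∀ u v → E u v → OrderedAbelianGroup._<_ 𝕂 (w u) (w v)) →
      (γ : OrderedAbelianGroup.Carrier 𝕂) →
      OrderedAbelianGroup._≤_ 𝕂 (OrderedAbelianGroup.0# 𝕂) γ →
      ∀ u v → tr (Star E) (tℓ (Star E) (Graph.RG 𝕂 E w γ)) u v ⇔ Graph.TightPair 𝕂 E w γ u v)
theorem2 =
  (λ A _ _≤_ partialOrder R convex → t⇔tr∘tℓ (IsPartialOrder.isPreorder partialOrder) convex) ,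
  (λ 𝕂 V _ E w _ w-increasing γ _ u v →
    let open GraphProperties 𝕂 E w w-increasing
    in t⇔TightPair γ u v ⇔-∘ ⇔-sym (t⇔tr∘tℓ (Star.isPreorder E) (RG-convex γ) u v))
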